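{- For nonnegative integers $p_1,p_2$, let $\bar{\chi}_{p_1,p_2}(q,t)$ denote the coboundary polynomial of the complete bipartite graph $K_{p_1,p_2}$. Then for every positive integer $q$, the following identity holds in the formal power series ring $\mathbb{Q}[t][[x_1,x_2]]$: $$1+q \left(\sum_{(p_1,p_2) \in \mathbb{N}^2\setminus\{(0,0)\}} \bar{\chi}_{p_1,p_2}(q,t) \, \frac{x_1^{p_1} x_2^{p_2}}{p_1!\,p_2!}\right) = \left( \sum_{(m_1,m_2) \in \mathbb{N}^2} t^{m_1 m_2} \frac{x_1^{m_1} x_2^{m_2}}{m_1!\,m_2!} \right)^q.$$
   Context: $\mathbb{N}=\{0,1,2,\dots\}$. $K_{p_1,p_2}$ is the complete bipartite graph with vertex set $V_1\sqcup V_2$, $|V_1|=p_1$, $|V_2|=p_2$ (if one part is empty, it has no edges). For a graph $G=(V,E)$, its coboundary polynomial is $$\bar\chi_G(q,t) = q^{ -1}\sum_{f:V \to \{1,2,\ldots,q\}} t^{\left|\{\{v_1,v_2\} \in E:\; f(v_1)=f(v_2)\}\right|},$$ the sum being over all vertex colorings $f$ with $q$ colors; equivalently $\bar\chi_G(q,t)=(t-1)^{|V|-c(G)}T_G\left(\frac{q+t-1}{t-1},t\right)$ where $c(G)$ is the number of connected components and $T_G$ is the Tutte polynomial of the graphic matroid of $G$. -}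

module Defs where

open import Data.Nat using (ℕ; zero; suc; _∸_; _!; NonZero; _<?_) renaming (_*_ to _*ℕ_)
open import Data.Nat.Properties using (_!*_!≢0)
open import Data.Integer using (+_)
open import Data.Rational using (ℚ; 0ℚ; 1ℚ; _/_; _+_; _*_)
open import Data.Fin using (Fin; toℕ) renaming (zero to fz; suc to fs)
import Data.Fin as F
open import Data.List using (List; []; _∷_; [_]; map; foldr; replicate; _++_; concatMap; upTo; allFin)
open import Data.Nat.ListAction using (sum)
open import Data.Bool using (Bool; true; false; if_then_else_; _∧_; _xor_)
open import Relation.Nullary.Decidable using (⌊_⌋)
open import Relation.Binary.PropositionalEquality using (_≡_)

-- Polynomials in t over ℚ: coefficient lists, lowest degree first.

Poly : Set
Poly = List ℚ

_+P_ : Poly → Poly → Poly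
[] +P q = q
(a ∷ p) +P [] = a ∷ p
(a ∷ p) +P (b ∷ q) = (a + b) ∷ (p +P q)

scaleP : ℚ → Poly → Poly
scaleP c = map (c *_)

_*P_ : Poly → Poly → Poly
[] *P q = []
(a ∷ p) *P q = scaleP a q +P (0ℚ ∷ (p *P q))

sumP : List Poly → Poly
sumP = foldr _+P_ []

coeffP : Poly → ℕ → ℚ
coeffP [] _ = 0ℚ
coeffP (a ∷ p) zero = a
coeffP (a ∷ p) (suc k) = coeffP p k

-- equality of polynomials (coefficientwise; insensitive to trailing zeros)
_≈P_ : Poly → Poly → Set
p ≈P q = ∀ k → coeffP p k ≡ coeffP q k

tPow : ℕ → Poly
tPow k = replicate k 0ℚ ++ [ 1ℚ ]

-- Formal power series in x₁, x₂ with coefficients in ℚ[t]: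
-- S m₁ m₂ is the coefficient of x₁^m₁ x₂^m₂.

PS : Set
PS = ℕ → ℕ → Poly

oneS : PS
oneS zero zero = [ 1ℚ ]
oneS zero (suc _) = []
oneS (suc _) _ = []

_+S_ : PS → PS → PS
(F +S G) a b = F a b +P G a b

_*S_ : PS → PS → PS
(F *S G) a b =
  sumP (map (λ i → sumP (map (λ j → F i j *P G (a ∸ i) (b ∸ j)) (upTo (suc b)))) (upTo (suc a)))

_^S_ : PS → ℕ → PS
F ^S zero = oneS
F ^S suc q = F *S (F ^S q)

_≈S_ : PS → PS → Set
F ≈S G = ∀ a b → F a b ≈P G a b

-- Finite simple graphs on vertex set Fin n, given by an adjacency
-- predicate; the edge set is {{i,j} : i < j, adj i j = true}.

Graph : ℕ → Set
Graph n = Fin n → Fin n → Bool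

inV₁ : (p₁ p₂ : ℕ) → Fin (p₁ Data.Nat.+ p₂) → Bool
inV₁ p₁ p₂ i = ⌊ toℕ i <? p₁ ⌋

K : (p₁ p₂ : ℕ) → Graph (p₁ Data.Nat.+ p₂)
K p₁ p₂ i j = inV₁ p₁ p₂ i xor inV₁ p₁ p₂ j

consF : ∀ {n q} → Fin q → (Fin n → Fin q) → Fin (suc n) → Fin q
consF c g fz = c
consF c g (fs i) = g i

colourings : (n q : ℕ) → List (Fin n → Fin q)
colourings zero q = [ (λ ()) ]
colourings (suc n) q = concatMap (λ c → map (consF c) (colourings n q)) (allFin q)

mono : ∀ {n q} → Graph n → (Fin n → Fin q) → ℕ
mono {n} G f =
  sum (map (λ i → sum (map (λ j →
    if G i j ∧ ⌊ toℕ i <? toℕ j ⌋ ∧ ⌊ f i F.≟ f j ⌋ then 1 else 0) (allFin n))) (allFin n))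

coboundary : ∀ {n} → Graph n → (q : ℕ) → .{{NonZero q}} → Poly
coboundary {n} G q = scaleP (+ 1 / q) (sumP (map (λ f → tPow (mono G f)) (colourings n q)))

cobSeries : (q : ℕ) → .{{NonZero q}} → PS
cobSeries q zero zero = []
cobSeries q p₁ p₂ =
  scaleP ((+ 1 / (p₁ ! *ℕ p₂ !)) {{p₁ !* p₂ !≢0}}) (coboundary (K p₁ p₂) q)

lhsSeries : (q : ℕ) → .{{NonZero q}} → PS
lhsSeries q = oneS +S (λ a b → scaleP (+ q / 1) (cobSeries q a b))

expSeries : PS
expSeries m₁ m₂ = scaleP ((+ 1 / (m₁ ! *ℕ m₂ !)) {{m₁ !* m₂ !≢0}}) (tPow (m₁ *ℕ m₂))

-- Colour K_{a,b} with q colours. If colour c occurs m_c times on V₁ and n_c times on V₂, exactly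
-- Σ_c m_c n_c edges are monochromatic, so q χ̄_{a,b}(q,t) is a sum of t^{Σ_c m_c n_c} over pairs of
-- colourings of V₁ and V₂. Splitting off the i vertices of V₁ and the j vertices of V₂ that receive
-- the first colour contributes C(a,i) C(b,j) t^{ij} times the same sum for q − 1 colours on the rest.
-- With the weights 1/(a! b!) this binomial convolution becomes the Cauchy product of exponential
-- generating functions, so induction on q yields the q-th power of the series for one colour.
module Submission where

open import Defs

open import Algebra.Bundles using (CommutativeMonoid; CommutativeRing)
import Algebra.Properties.CommutativeSemigroup as CommSemigroupProperties
open import Data.Bool using (Bool; not; _∧_; _xor_; if_then_else_)
open import Data.Bool.Properties using (∧-zeroʳ)
open import Data.Fin using (Fin; toℕ) renaming (zero to fz; suc to fs)
import Data.Fin.Properties as F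
open import Data.Integer using (+_)
import Data.Integer as ℤ
import Data.Integer.Properties as ℤ
open import Data.List using (List; []; _∷_; [_]; map; _++_; concatMap; upTo; allFin)
import Data.List.Properties as List
open import Data.Nat using (ℕ; zero; suc; _+_; _*_; _∸_; _!; _<?_; s<s; s<s⁻¹; NonZero)
import Data.Nat as ℕ
open import Data.Nat.Combinatorics using (_C_; nCn≡1; nCk≡n!/k![n-k]!; k![n∸k]!∣n!; nCk+nC[k+1]≡[n+1]C[k+1])
open import Data.Nat.DivMod using (m/n*n≡m)
open import Data.Nat.ListAction using (sum)
import Data.Nat.Properties as ℕ
open import Data.Nat.Tactic.RingSolver using (solve; solve-∀)
open import Data.Product using (_×_; _,_; proj₁; proj₂)
open import Data.Rational as ℚ using (ℚ; 0ℚ; 1ℚ; _/_)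
import Data.Rational.Properties as ℚ
import Data.Rational.Unnormalised as ℚᵘ
import Data.Rational.Unnormalised.Properties as ℚᵘ
open import Data.Unit using (⊤; tt)
open import Function using (_∘_; _⇔_; mk⇔)
open import Level using (0ℓ)
open import Relation.Binary.Bundles using (Setoid)
open import Relation.Binary.PropositionalEquality
  using (_≡_; refl; sym; trans; subst; cong; cong₂; module ≡-Reasoning)
open import Relation.Binary.PropositionalEquality.Algebra using (isMagma)
import Relation.Binary.Reasoning.Setoid as SetoidReasoning
open import Relation.Nullary.Decidable using (Dec; ⌊_⌋; isYes≗does; does-⇔)

-- Polynomial arithmetic

+P-identityʳ : ∀ p → p +P [] ≡ p
+P-identityʳ []      = refl
+P-identityʳ (_ ∷ _) = refl

+P-comm : ∀ p q → p +P q ≡ q +P p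
+P-comm []      q       = sym (+P-identityʳ q)
+P-comm (a ∷ p) []      = refl
+P-comm (a ∷ p) (b ∷ q) = cong₂ _∷_ (ℚ.+-comm a b) (+P-comm p q)

+P-assoc : ∀ p q r → (p +P q) +P r ≡ p +P (q +P r)
+P-assoc []      q       r       = refl
+P-assoc (a ∷ p) []      r       = refl
+P-assoc (a ∷ p) (b ∷ q) []      = refl
+P-assoc (a ∷ p) (b ∷ q) (c ∷ r) = cong₂ _∷_ (ℚ.+-assoc a b c) (+P-assoc p q r)

+P-commutativeMonoid : CommutativeMonoid 0ℓ 0ℓ
+P-commutativeMonoid = record
  { Carrier             = Poly
  ; _≈_                 = _≡_
  ; _∙_                 = _+P_
  ; ε                   = []
  ; isCommutativeMonoid = record
    { isMonoid = record
      { isSemigroup = record { isMagma = isMagma _+P_ ; assoc = +P-assoc }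
      ; identity    = (λ _ → refl) , +P-identityʳ
      }
    ; comm     = +P-comm
    }
  }

module +P = CommSemigroupProperties (CommutativeMonoid.commutativeSemigroup +P-commutativeMonoid)

scaleP-distribˡ : ∀ c p q → scaleP c (p +P q) ≡ scaleP c p +P scaleP c q
scaleP-distribˡ c []      q       = refl
scaleP-distribˡ c (a ∷ p) []      = refl
scaleP-distribˡ c (a ∷ p) (b ∷ q) = cong₂ _∷_ (ℚ.*-distribˡ-+ c a b) (scaleP-distribˡ c p q)

scaleP-distribʳ : ∀ c d p → scaleP (c ℚ.+ d) p ≡ scaleP c p +P scaleP d p
scaleP-distribʳ c d []      = refl
scaleP-distribʳ c d (a ∷ p) = cong₂ _∷_ (ℚ.*-distribʳ-+ a c d) (scaleP-distribʳ c d p)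

scaleP-assoc : ∀ c d p → scaleP c (scaleP d p) ≡ scaleP (c ℚ.* d) p
scaleP-assoc c d p = trans (sym (List.map-∘ p)) (List.map-cong (λ a → sym (ℚ.*-assoc c d a)) p)

scaleP-identity : ∀ p → scaleP 1ℚ p ≡ p
scaleP-identity p = trans (List.map-cong ℚ.*-identityˡ p) (List.map-id p)

scaleP-0∷ : ∀ c p → scaleP c (0ℚ ∷ p) ≡ 0ℚ ∷ scaleP c p
scaleP-0∷ c p = cong (_∷ scaleP c p) (ℚ.*-zeroʳ c)

-- _≈P_ wrapped in a record, so that both polynomials can be inferred from a proof. Coefficientwise
-- equality is needed only because _*P_ can leave trailing zeros; most laws hold with ≡.
infix 4 _≋_
record _≋_ (p q : Poly) : Set where
  constructor mk≋
  field coeff-≡ : p ≈P q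
open _≋_

≋-setoid : Setoid 0ℓ 0ℓ
≋-setoid = record
  { Carrier       = Poly
  ; _≈_           = _≋_
  ; isEquivalence = record
    { refl  = mk≋ λ _ → refl
    ; sym   = λ (mk≋ p≈q) → mk≋ λ k → sym (p≈q k)
    ; trans = λ (mk≋ p≈q) (mk≋ q≈r) → mk≋ λ k → trans (p≈q k) (q≈r k)
    }
  }

open Setoid ≋-setoid using () renaming (refl to ≋-refl; sym to ≋-sym; trans to ≋-trans; reflexive to ≡⇒≋)
module ≋-Reasoning = SetoidReasoning ≋-setoid

coeff-+P : ∀ p q k → coeffP (p +P q) k ≡ coeffP p k ℚ.+ coeffP q k
coeff-+P []      q       k       = sym (ℚ.+-identityˡ (coeffP q k))
coeff-+P (a ∷ p) []      k       = sym (ℚ.+-identityʳ (coeffP (a ∷ p) k))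
coeff-+P (a ∷ p) (b ∷ q) zero    = refl
coeff-+P (a ∷ p) (b ∷ q) (suc k) = coeff-+P p q k

coeff-scaleP : ∀ c p k → coeffP (scaleP c p) k ≡ c ℚ.* coeffP p k
coeff-scaleP c []      k       = sym (ℚ.*-zeroʳ c)
coeff-scaleP c (a ∷ p) zero    = refl
coeff-scaleP c (a ∷ p) (suc k) = coeff-scaleP c p k

+P-cong : ∀ {p p′ q q′} → p ≋ p′ → q ≋ q′ → p +P q ≋ p′ +P q′
+P-cong {p} {p′} {q} {q′} (mk≋ p≈p′) (mk≋ q≈q′) = mk≋ λ k → begin
  coeffP (p +P q) k             ≡⟨ coeff-+P p q k ⟩
  coeffP p k ℚ.+ coeffP q k     ≡⟨ cong₂ ℚ._+_ (p≈p′ k) (q≈q′ k) ⟩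
  coeffP p′ k ℚ.+ coeffP q′ k   ≡⟨ coeff-+P p′ q′ k ⟨
  coeffP (p′ +P q′) k           ∎
  where open ≡-Reasoning

scaleP-cong : ∀ c {p q} → p ≋ q → scaleP c p ≋ scaleP c q
scaleP-cong c {p} {q} (mk≋ p≈q) = mk≋ λ k → begin
  coeffP (scaleP c p) k   ≡⟨ coeff-scaleP c p k ⟩
  c ℚ.* coeffP p k        ≡⟨ cong (c ℚ.*_) (p≈q k) ⟩
  c ℚ.* coeffP q k        ≡⟨ coeff-scaleP c q k ⟨
  coeffP (scaleP c q) k   ∎
  where open ≡-Reasoning

∷-cong : ∀ a {p q} → p ≋ q → a ∷ p ≋ a ∷ q
∷-cong a (mk≋ p≈q) = mk≋ λ { zero → refl ; (suc k) → p≈q k }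

[0]≋[] : [ 0ℚ ] ≋ []
[0]≋[] = mk≋ λ { zero → refl ; (suc k) → refl }

scaleP-zeroˡ : ∀ p → scaleP 0ℚ p ≋ []
scaleP-zeroˡ p = mk≋ λ k → trans (coeff-scaleP 0ℚ p k) (ℚ.*-zeroˡ (coeffP p k))

*P-congˡ : ∀ p {q q′} → q ≋ q′ → p *P q ≋ p *P q′
*P-congˡ []      q≋q′ = ≋-refl
*P-congˡ (a ∷ p) q≋q′ = +P-cong (scaleP-cong a q≋q′) (∷-cong 0ℚ (*P-congˡ p q≋q′))

*P-zeroʳ : ∀ p → p *P [] ≋ []
*P-zeroʳ []      = ≋-refl
*P-zeroʳ (a ∷ p) = ≋-trans (∷-cong 0ℚ (*P-zeroʳ p)) [0]≋[]

*P-distribˡ : ∀ p q r → p *P (q +P r) ≡ (p *P q) +P (p *P r)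
*P-distribˡ []      q r = refl
*P-distribˡ (a ∷ p) q r = begin
  scaleP a (q +P r) +P (0ℚ ∷ p *P (q +P r))
    ≡⟨ cong₂ (λ s t → s +P (0ℚ ∷ t)) (scaleP-distribˡ a q r) (*P-distribˡ p q r) ⟩
  (scaleP a q +P scaleP a r) +P ((0ℚ ∷ p *P q) +P (0ℚ ∷ p *P r))
    ≡⟨ +P.interchange (scaleP a q) (scaleP a r) (0ℚ ∷ p *P q) (0ℚ ∷ p *P r) ⟩
  (scaleP a q +P (0ℚ ∷ p *P q)) +P (scaleP a r +P (0ℚ ∷ p *P r)) ∎
  where open ≡-Reasoning

*P-scaleˡ : ∀ c p q → scaleP c p *P q ≡ scaleP c (p *P q)
*P-scaleˡ c []      q = refl
*P-scaleˡ c (a ∷ p) q = begin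
  scaleP (c ℚ.* a) q +P (0ℚ ∷ scaleP c p *P q)
    ≡⟨ cong₂ (λ s t → s +P (0ℚ ∷ t)) (sym (scaleP-assoc c a q)) (*P-scaleˡ c p q) ⟩
  scaleP c (scaleP a q) +P (0ℚ ∷ scaleP c (p *P q))
    ≡⟨ cong (scaleP c (scaleP a q) +P_) (scaleP-0∷ c (p *P q)) ⟨
  scaleP c (scaleP a q) +P scaleP c (0ℚ ∷ p *P q)
    ≡⟨ scaleP-distribˡ c (scaleP a q) (0ℚ ∷ p *P q) ⟨
  scaleP c (scaleP a q +P (0ℚ ∷ p *P q)) ∎
  where open ≡-Reasoning

*P-scaleʳ : ∀ c p q → p *P scaleP c q ≡ scaleP c (p *P q)
*P-scaleʳ c []      q = refl
*P-scaleʳ c (a ∷ p) q = begin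
  scaleP a (scaleP c q) +P (0ℚ ∷ p *P scaleP c q)
    ≡⟨ cong₂ (λ s t → s +P (0ℚ ∷ t)) (scaleP-assoc a c q) (*P-scaleʳ c p q) ⟩
  scaleP (a ℚ.* c) q +P (0ℚ ∷ scaleP c (p *P q))
    ≡⟨ cong₂ (λ d t → scaleP d q +P t) (ℚ.*-comm c a) (scaleP-0∷ c (p *P q)) ⟨
  scaleP (c ℚ.* a) q +P scaleP c (0ℚ ∷ p *P q)
    ≡⟨ cong (_+P scaleP c (0ℚ ∷ p *P q)) (scaleP-assoc c a q) ⟨
  scaleP c (scaleP a q) +P scaleP c (0ℚ ∷ p *P q)
    ≡⟨ scaleP-distribˡ c (scaleP a q) (0ℚ ∷ p *P q) ⟨
  scaleP c (scaleP a q +P (0ℚ ∷ p *P q)) ∎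
  where open ≡-Reasoning

tPow-+ : ∀ m n → tPow (m + n) ≋ tPow m *P tPow n
tPow-+ zero    n = ≋-sym (begin
  scaleP 1ℚ (tPow n) +P [ 0ℚ ]   ≈⟨ +P-cong (≋-refl {scaleP 1ℚ (tPow n)}) [0]≋[] ⟩
  scaleP 1ℚ (tPow n) +P []       ≡⟨ +P-identityʳ _ ⟩
  scaleP 1ℚ (tPow n)             ≡⟨ scaleP-identity (tPow n) ⟩
  tPow n                         ∎)
  where open ≋-Reasoning
tPow-+ (suc m) n = begin
  0ℚ ∷ tPow (m + n)                              ≈⟨ ∷-cong 0ℚ (tPow-+ m n) ⟩
  0ℚ ∷ tPow m *P tPow n                          ≈⟨ +P-cong (scaleP-zeroˡ (tPow n)) ≋-refl ⟨
  scaleP 0ℚ (tPow n) +P (0ℚ ∷ tPow m *P tPow n)  ∎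
  where open ≋-Reasoning

-- Finite sums and antidiagonal sums

Σ : ∀ {A : Set} → List A → (A → Poly) → Poly
Σ xs f = sumP (map f xs)

Σ-cong : ∀ {A : Set} (xs : List A) {f g : A → Poly} → (∀ x → f x ≡ g x) → Σ xs f ≡ Σ xs g
Σ-cong xs f≡g = cong sumP (List.map-cong f≡g xs)

Σ-cong≋ : ∀ {A : Set} (xs : List A) {f g : A → Poly} → (∀ x → f x ≋ g x) → Σ xs f ≋ Σ xs g
Σ-cong≋ []       f≋g = ≋-refl
Σ-cong≋ (x ∷ xs) f≋g = +P-cong (f≋g x) (Σ-cong≋ xs f≋g)

Σ-map : ∀ {A B : Set} (h : A → B) (xs : List A) (f : B → Poly) → Σ (map h xs) f ≡ Σ xs (f ∘ h)
Σ-map h xs f = cong sumP (sym (List.map-∘ xs))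

Σ-++ : ∀ {A : Set} (xs ys : List A) (f : A → Poly) → Σ (xs ++ ys) f ≡ Σ xs f +P Σ ys f
Σ-++ []       ys f = refl
Σ-++ (x ∷ xs) ys f = trans (cong (f x +P_) (Σ-++ xs ys f)) (sym (+P-assoc (f x) (Σ xs f) (Σ ys f)))

Σ-concatMap : ∀ {A B : Set} (g : A → List B) (xs : List A) (f : B → Poly) →
              Σ (concatMap g xs) f ≡ Σ xs (λ x → Σ (g x) f)
Σ-concatMap g []       f = refl
Σ-concatMap g (x ∷ xs) f =
  trans (Σ-++ (g x) (concatMap g xs) f) (cong (Σ (g x) f +P_) (Σ-concatMap g xs f))

Σ-+P : ∀ {A : Set} (xs : List A) (f g : A → Poly) → Σ xs (λ x → f x +P g x) ≡ Σ xs f +P Σ xs g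
Σ-+P []       f g = refl
Σ-+P (x ∷ xs) f g =
  trans (cong ((f x +P g x) +P_) (Σ-+P xs f g)) (+P.interchange (f x) (g x) (Σ xs f) (Σ xs g))

Σ-*P : ∀ {A : Set} (xs : List A) (p : Poly) (f : A → Poly) → Σ xs (λ x → p *P f x) ≋ p *P Σ xs f
Σ-*P []       p f = ≋-sym (*P-zeroʳ p)
Σ-*P (x ∷ xs) p f =
  ≋-trans (+P-cong ≋-refl (Σ-*P xs p f)) (≡⇒≋ (sym (*P-distribˡ p (f x) (Σ xs f))))

Σ-zero : ∀ {A : Set} (xs : List A) → Σ xs (λ _ → []) ≡ []
Σ-zero []       = refl
Σ-zero (x ∷ xs) = Σ-zero xs

Σ-comm : ∀ {A B : Set} (xs : List A) (ys : List B) (f : A → B → Poly) →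
         Σ xs (λ x → Σ ys (f x)) ≡ Σ ys (λ y → Σ xs (λ x → f x y))
Σ-comm []       ys f = sym (Σ-zero ys)
Σ-comm (x ∷ xs) ys f =
  trans (cong (Σ ys (f x) +P_) (Σ-comm xs ys f)) (sym (Σ-+P ys (f x) (λ y → Σ xs (λ x → f x y))))

map-allFin-suc : ∀ {A : Set} n (f : Fin (suc n) → A) →
                 map f (allFin (suc n)) ≡ f fz ∷ map (f ∘ fs) (allFin n)
map-allFin-suc n f =
  cong (f fz ∷_) (trans (List.map-tabulate fs f) (sym (List.map-tabulate (λ i → i) (f ∘ fs))))

map-upTo-suc : ∀ {A : Set} n (f : ℕ → A) → map f (upTo (suc n)) ≡ f 0 ∷ map (f ∘ suc) (upTo n)
map-upTo-suc n f =
  cong (f 0 ∷_) (trans (List.map-applyUpTo suc f n) (sym (List.map-applyUpTo (λ i → i) (f ∘ suc) n)))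

antidiagonal : ℕ → (ℕ → ℕ → Poly) → Poly
antidiagonal zero    f = f 0 0
antidiagonal (suc n) f = f 0 (suc n) +P antidiagonal n (λ j k → f (suc j) k)

antidiagonal-cong : ∀ n {f g : ℕ → ℕ → Poly} → (∀ j k → j + k ≡ n → f j k ≡ g j k) →
                    antidiagonal n f ≡ antidiagonal n g
antidiagonal-cong zero    f≡g = f≡g 0 0 refl
antidiagonal-cong (suc n) f≡g =
  cong₂ _+P_ (f≡g 0 (suc n) refl) (antidiagonal-cong n (λ j k j+k≡n → f≡g (suc j) k (cong suc j+k≡n)))

antidiagonal-cong≋ : ∀ n {f g : ℕ → ℕ → Poly} → (∀ j k → f j k ≋ g j k) →
                     antidiagonal n f ≋ antidiagonal n g
antidiagonal-cong≋ zero    f≋g = f≋g 0 0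
antidiagonal-cong≋ (suc n) f≋g = +P-cong (f≋g 0 (suc n)) (antidiagonal-cong≋ n (λ j → f≋g (suc j)))

antidiagonal-snoc : ∀ n f → antidiagonal (suc n) f ≡ antidiagonal n (λ j k → f j (suc k)) +P f (suc n) 0
antidiagonal-snoc zero    f = refl
antidiagonal-snoc (suc n) f =
  trans (cong (f 0 (suc (suc n)) +P_) (antidiagonal-snoc n (λ j k → f (suc j) k)))
        (sym (+P-assoc (f 0 (suc (suc n))) _ (f (suc (suc n)) 0)))

antidiagonal-+P : ∀ n f g →
                  antidiagonal n (λ j k → f j k +P g j k) ≡ antidiagonal n f +P antidiagonal n g
antidiagonal-+P zero    f g = refl
antidiagonal-+P (suc n) f g =
  trans (cong ((f 0 (suc n) +P g 0 (suc n)) +P_) (antidiagonal-+P n (λ j → f (suc j)) (λ j → g (suc j))))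
        (+P.interchange (f 0 (suc n)) (g 0 (suc n)) _ _)

antidiagonal-scaleP : ∀ n c f → antidiagonal n (λ j k → scaleP c (f j k)) ≡ scaleP c (antidiagonal n f)
antidiagonal-scaleP zero    c f = refl
antidiagonal-scaleP (suc n) c f =
  trans (cong (scaleP c (f 0 (suc n)) +P_) (antidiagonal-scaleP n c (λ j → f (suc j))))
        (sym (scaleP-distribˡ c (f 0 (suc n)) _))

Σ-upTo-antidiagonal : ∀ n f → Σ (upTo (suc n)) (λ i → f i (n ∸ i)) ≡ antidiagonal n f
Σ-upTo-antidiagonal zero    f = +P-identityʳ (f 0 0)
Σ-upTo-antidiagonal (suc n) f =
  trans (cong sumP (map-upTo-suc (suc n) (λ i → f i (suc n ∸ i))))
        (cong (f 0 (suc n) +P_) (Σ-upTo-antidiagonal n (λ j → f (suc j))))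

*S-antidiagonal : ∀ F G a b →
                  (F *S G) a b ≡ antidiagonal a (λ i k → antidiagonal b (λ j l → F i j *P G k l))
*S-antidiagonal F G a b = begin
  Σ (upTo (suc a)) (λ i → Σ (upTo (suc b)) (λ j → F i j *P G (a ∸ i) (b ∸ j)))
    ≡⟨ Σ-cong (upTo (suc a)) (λ i → Σ-upTo-antidiagonal b (λ j l → F i j *P G (a ∸ i) l)) ⟩
  Σ (upTo (suc a)) (λ i → antidiagonal b (λ j l → F i j *P G (a ∸ i) l))
    ≡⟨ Σ-upTo-antidiagonal a (λ i k → antidiagonal b (λ j l → F i j *P G k l)) ⟩
  antidiagonal a (λ i k → antidiagonal b (λ j l → F i j *P G k l)) ∎
  where open ≡-Reasoning

-- Binomial coefficients and exponential weights

binomial : ℕ → ℕ → ℕ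
binomial j k = (j + k) C j

binomial-pascal : ∀ j k → binomial j (suc k) + binomial (suc j) k ≡ binomial (suc j) (suc k)
binomial-pascal j k =
  subst (λ n → (j + suc k) C j + n C suc j ≡ suc (j + suc k) C suc j)
        (ℕ.+-suc j k) (nCk+nC[k+1]≡[n+1]C[k+1] (j + suc k) j)

binomial-zeroʳ : ∀ n → binomial n 0 ≡ 1
binomial-zeroʳ n = trans (cong (_C n) (ℕ.+-identityʳ n)) (nCn≡1 n)

binomial-factorial : ∀ j k → binomial j k * (j ! * k !) ≡ (j + k) !
binomial-factorial j k = begin
  ((j + k) C j) * (j ! * k !)
    ≡⟨ cong (λ m → ((j + k) C j) * (j ! * m !)) (ℕ.m+n∸m≡n j k) ⟨
  ((j + k) C j) * (j ! * (j + k ∸ j) !)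
    ≡⟨ cong (_* (j ! * (j + k ∸ j) !)) (nCk≡n!/k![n-k]! j≤j+k) ⟩
  ((j + k) ! ℕ./ (j ! * (j + k ∸ j) !)) * (j ! * (j + k ∸ j) !)
    ≡⟨ m/n*n≡m (k![n∸k]!∣n! j≤j+k) ⟩
  (j + k) ! ∎
  where
  open ≡-Reasoning
  j≤j+k = ℕ.m≤m+n j k
  instance
    _ : NonZero (j ! * (j + k ∸ j) !)
    _ = j ℕ.!* (j + k ∸ j) !≢0

toℚᵘ-/ : ∀ n d → ℚ.toℚᵘ (+ n / suc d) ℚᵘ.≃ ℚᵘ.mkℚᵘ (+ n) d
toℚᵘ-/ n d = ℚ.toℚᵘ-fromℚᵘ (ℚᵘ.mkℚᵘ (+ n) d)

/-cross : ∀ m n d e .{{_ : NonZero d}} .{{_ : NonZero e}} → m * e ≡ n * d → + m / d ≡ + n / e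
/-cross m n (suc d) (suc e) me≡nd = ℚ.fromℚᵘ-cong {ℚᵘ.mkℚᵘ (+ m) d} {ℚᵘ.mkℚᵘ (+ n) e}
  (ℚᵘ.*≡* (trans (sym (ℤ.pos-* m (suc e))) (trans (cong +_ me≡nd) (ℤ.pos-* n (suc d)))))

/-* : ∀ m n d e .{{_ : NonZero d}} .{{_ : NonZero e}} →
      (+ m / d) ℚ.* (+ n / e) ≡ (+ (m * n) / (d * e)) {{ℕ.m*n≢0 d e}}
/-* m n (suc d) (suc e) = ℚ.toℚᵘ-injective (begin
  ℚ.toℚᵘ ((+ m / suc d) ℚ.* (+ n / suc e))
    ≈⟨ ℚ.toℚᵘ-homo-* (+ m / suc d) (+ n / suc e) ⟩
  ℚ.toℚᵘ (+ m / suc d) ℚᵘ.* ℚ.toℚᵘ (+ n / suc e)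
    ≈⟨ ℚᵘ.*-cong (toℚᵘ-/ m d) (toℚᵘ-/ n e) ⟩
  ℚᵘ.mkℚᵘ (+ m) d ℚᵘ.* ℚᵘ.mkℚᵘ (+ n) e
    ≈⟨ ℚᵘ.*≡* (cong (ℤ._* + suc d′) (sym (ℤ.pos-* m n))) ⟩
  ℚᵘ.mkℚᵘ (+ (m * n)) d′
    ≈⟨ toℚᵘ-/ (m * n) d′ ⟨
  ℚ.toℚᵘ (+ (m * n) / (suc d * suc e)) ∎)
  where
  open ℚᵘ.≃-Reasoning
  d′ = e + d * suc e

fromℕ : ℕ → ℚ
fromℕ n = + n / 1

fromℕ-+ : ∀ m n → fromℕ (m + n) ≡ fromℕ m ℚ.+ fromℕ n
fromℕ-+ m n = sym (ℚ.toℚᵘ-injective (begin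
  ℚ.toℚᵘ (fromℕ m ℚ.+ fromℕ n)               ≈⟨ ℚ.toℚᵘ-homo-+ (fromℕ m) (fromℕ n) ⟩
  ℚ.toℚᵘ (fromℕ m) ℚᵘ.+ ℚ.toℚᵘ (fromℕ n)     ≈⟨ ℚᵘ.+-cong (toℚᵘ-/ m 0) (toℚᵘ-/ n 0) ⟩
  ℚᵘ.mkℚᵘ (+ m) 0 ℚᵘ.+ ℚᵘ.mkℚᵘ (+ n) 0       ≈⟨ ℚᵘ.*≡* (cong (ℤ._* + 1) m+n≡) ⟩
  ℚᵘ.mkℚᵘ (+ (m + n)) 0                      ≈⟨ toℚᵘ-/ (m + n) 0 ⟨
  ℚ.toℚᵘ (fromℕ (m + n))                     ∎))
  where
  open ℚᵘ.≃-Reasoning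
  m+n≡ : + m ℤ.* + 1 ℤ.+ + n ℤ.* + 1 ≡ + (m + n)
  m+n≡ = trans (cong₂ ℤ._+_ (ℤ.*-identityʳ (+ m)) (ℤ.*-identityʳ (+ n))) (sym (ℤ.pos-+ m n))

fromℕ-*-/ : ∀ n .{{_ : NonZero n}} → fromℕ n ℚ.* (+ 1 / n) ≡ 1ℚ
fromℕ-*-/ n = trans (/-* n 1 1 n) (/-cross (n * 1) 1 (1 * n) 1 {{ℕ.m*n≢0 1 n}} (solve (n ∷ [])))

weight : ℕ → ℕ → ℚ
weight a b = (+ 1 / (a ! * b !)) {{a ℕ.!* b !≢0}}

weight-binomial : ∀ {a b} i j k l → i + k ≡ a → j + l ≡ b →
  weight a b ℚ.* (fromℕ (binomial i k) ℚ.* fromℕ (binomial j l)) ≡ weight i j ℚ.* weight k l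
weight-binomial i j k l refl refl = begin
  weight (i + k) (j + l) ℚ.* (fromℕ x ℚ.* fromℕ y)
    ≡⟨ cong (weight (i + k) (j + l) ℚ.*_) (/-* x y 1 1) ⟩
  weight (i + k) (j + l) ℚ.* (+ (x * y) / 1)
    ≡⟨ /-* 1 (x * y) ((i + k) ! * (j + l) !) 1 ⟩
  + (1 * (x * y)) / ((i + k) ! * (j + l) ! * 1)
    ≡⟨ /-cross (1 * (x * y)) (1 * 1) _ ((i ! * j !) * (k ! * l !)) cross ⟩
  + (1 * 1) / ((i ! * j !) * (k ! * l !))
    ≡⟨ /-* 1 1 (i ! * j !) (k ! * l !) ⟨
  weight i j ℚ.* weight k l ∎
  where
  open ≡-Reasoning
  x = binomial i k
  y = binomial j l
  instance
    _ : NonZero ((i + k) ! * (j + l) !)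
    _ = (i + k) ℕ.!* (j + l) !≢0
    _ : NonZero (i ! * j !)
    _ = i ℕ.!* j !≢0
    _ : NonZero (k ! * l !)
    _ = k ℕ.!* l !≢0
    _ : NonZero ((i + k) ! * (j + l) ! * 1)
    _ = ℕ.m*n≢0 ((i + k) ! * (j + l) !) 1
    _ : NonZero ((i ! * j !) * (k ! * l !))
    _ = ℕ.m*n≢0 (i ! * j !) (k ! * l !)
  cross : 1 * (x * y) * ((i ! * j !) * (k ! * l !)) ≡ 1 * 1 * ((i + k) ! * (j + l) ! * 1)
  cross = begin
    1 * (x * y) * ((i ! * j !) * (k ! * l !))   ≡⟨ regroup x y (i !) (j !) (k !) (l !) ⟩
    (x * (i ! * k !)) * (y * (j ! * l !))       ≡⟨ cong₂ _*_ (binomial-factorial i k) (binomial-factorial j l) ⟩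
    (i + k) ! * (j + l) !                       ≡⟨ pad ((i + k) !) ((j + l) !) ⟩
    1 * 1 * ((i + k) ! * (j + l) ! * 1)         ∎
    where
    regroup : ∀ x y a b c d → 1 * (x * y) * ((a * b) * (c * d)) ≡ (x * (a * c)) * (y * (b * d))
    regroup = solve-∀
    pad : ∀ u v → u * v ≡ 1 * 1 * (u * v * 1)
    pad = solve-∀

binomialScale : ℕ → ℕ → Poly → Poly
binomialScale j k = scaleP (fromℕ (binomial j k))

binomialScale-pascal : ∀ j k p →
  binomialScale (suc j) (suc k) p ≡ binomialScale j (suc k) p +P binomialScale (suc j) k p
binomialScale-pascal j k p = trans
  (cong (λ c → scaleP c p) (trans (cong fromℕ (sym (binomial-pascal j k))) (fromℕ-+ x y)))
  (scaleP-distribʳ (fromℕ x) (fromℕ y) p)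
  where
  x = binomial j (suc k)
  y = binomial (suc j) k

binomialScale-zeroʳ : ∀ n p → binomialScale n 0 p ≡ p
binomialScale-zeroʳ n p = trans (cong (λ c → scaleP (fromℕ c) p) (binomial-zeroʳ n)) (scaleP-identity p)

antidiagonal-pascal : ∀ n (X : ℕ → ℕ → Poly) →
  antidiagonal (suc n) (λ j k → binomialScale j k (X j k))
  ≡ antidiagonal n (λ j k → binomialScale j k (X (suc j) k))
    +P antidiagonal n (λ j k → binomialScale j k (X j (suc k)))
antidiagonal-pascal zero    X = +P-comm (binomialScale 0 1 (X 0 1)) (binomialScale 1 0 (X 1 0))
antidiagonal-pascal (suc n) X = begin
  first +P antidiagonal (suc n) (λ j → f (suc j))
    ≡⟨ cong (first +P_) (antidiagonal-snoc n (λ j → f (suc j))) ⟩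
  first +P (antidiagonal n (λ j k → f (suc j) (suc k)) +P f (suc (suc n)) 0)
    ≡⟨ cong₂ (λ s t → first +P (s +P t)) split
             (trans (binomialScale-zeroʳ (suc (suc n)) _) (sym (binomialScale-zeroʳ (suc n) _))) ⟩
  first +P ((antidiagonal n A +P antidiagonal n B) +P last)
    ≡⟨ cong (first +P_) (+P.xy∙z≈xz∙y (antidiagonal n A) (antidiagonal n B) last) ⟩
  first +P ((antidiagonal n A +P last) +P antidiagonal n B)
    ≡⟨ +P.x∙yz≈y∙xz first (antidiagonal n A +P last) (antidiagonal n B) ⟩
  (antidiagonal n A +P last) +P (first +P antidiagonal n B)
    ≡⟨ cong (_+P (first +P antidiagonal n B)) (antidiagonal-snoc n (λ j k → binomialScale j k (X (suc j) k))) ⟨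
  antidiagonal (suc n) (λ j k → binomialScale j k (X (suc j) k)) +P (first +P antidiagonal n B) ∎
  where
  open ≡-Reasoning
  f : ℕ → ℕ → Poly
  f j k = binomialScale j k (X j k)
  first = f 0 (suc (suc n))
  last  = binomialScale (suc n) 0 (X (suc (suc n)) 0)
  A B : ℕ → ℕ → Poly
  A j k = binomialScale j (suc k) (X (suc j) (suc k))
  B j k = binomialScale (suc j) k (X (suc j) (suc k))
  split : antidiagonal n (λ j k → f (suc j) (suc k)) ≡ antidiagonal n A +P antidiagonal n B
  split = trans (antidiagonal-cong n (λ j k _ → binomialScale-pascal j k (X (suc j) (suc k))))
                (antidiagonal-+P n A B)

-- Colour counts and monochromatic edges of K_{a,b}

-- Colour counts are iterated pairs rather than vectors: by η for pairs, a count vector over suc q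
-- colours is definitionally the pair of its head and tail, which the colour-peeling recursion uses.
Counts : ℕ → Set
Counts zero    = ⊤
Counts (suc q) = ℕ × Counts q

zeros : ∀ q → Counts q
zeros zero    = tt
zeros (suc q) = 0 , zeros q

bump : ∀ {q} → Fin q → Counts q → Counts q
bump fz     (m , v) = suc m , v
bump (fs c) (m , v) = m , bump c v

counts : ∀ {n q} → (Fin n → Fin q) → Counts q
counts {zero}  {q} g = zeros q
counts {suc n}     g = bump (g fz) (counts (g ∘ fs))

lookup : ∀ {q} → Counts q → Fin q → ℕ
lookup (m , v) fz     = m
lookup (m , v) (fs c) = lookup v c

infixl 7 _·_
_·_ : ∀ {q} → Counts q → Counts q → ℕ
_·_ {zero}  _       _       = 0
_·_ {suc q} (m , v) (n , w) = m * n + v · w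

indicator : Bool → ℕ
indicator b = if b then 1 else 0

⌊⌋-⇔ : ∀ {P Q : Set} → P ⇔ Q → (p? : Dec P) (q? : Dec Q) → ⌊ p? ⌋ ≡ ⌊ q? ⌋
⌊⌋-⇔ P⇔Q p? q? = trans (isYes≗does p?) (trans (does-⇔ P⇔Q p? q?) (sym (isYes≗does q?)))

≟-suc : ∀ {q} (c d : Fin q) → ⌊ fs c F.≟ fs d ⌋ ≡ ⌊ c F.≟ d ⌋
≟-suc c d = ⌊⌋-⇔ (mk⇔ F.suc-injective (cong fs)) (fs c F.≟ fs d) (c F.≟ d)

<?-suc : ∀ m n → ⌊ suc m <? suc n ⌋ ≡ ⌊ m <? n ⌋
<?-suc m n = ⌊⌋-⇔ (mk⇔ s<s⁻¹ s<s) (suc m <? suc n) (m <? n)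

lookup-zeros : ∀ {q} (c : Fin q) → lookup (zeros q) c ≡ 0
lookup-zeros fz     = refl
lookup-zeros (fs c) = lookup-zeros c

lookup-bump : ∀ {q} (d c : Fin q) v → lookup (bump d v) c ≡ indicator ⌊ c F.≟ d ⌋ + lookup v c
lookup-bump fz     fz     v = refl
lookup-bump fz     (fs c) v = refl
lookup-bump (fs d) fz     v = refl
lookup-bump (fs d) (fs c) v =
  trans (lookup-bump d c (proj₂ v)) (cong (λ b → indicator b + lookup (proj₂ v) c) (sym (≟-suc c d)))

·-zeros : ∀ {q} (w : Counts q) → zeros q · w ≡ 0
·-zeros {zero}  w = refl
·-zeros {suc q} w = ·-zeros (proj₂ w)

module +ℕ = CommSemigroupProperties ℕ.+-commutativeSemigroup

bump-· : ∀ {q} (d : Fin q) (v w : Counts q) → bump d v · w ≡ lookup w d + v · w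
bump-· fz     (m , v) (n , w) = ℕ.+-assoc n (m * n) (v · w)
bump-· (fs d) (m , v) (n , w) =
  trans (cong (_+_ (m * n)) (bump-· d v w)) (+ℕ.x∙yz≈y∙xz (m * n) (lookup w d) (v · w))

-- Unlike Data.Vec.Functional._++_, this concatenation computes on fs:
-- (g₁ ++ᶜ g₂) ∘ fs is definitionally (g₁ ∘ fs) ++ᶜ g₂.
infixr 5 _++ᶜ_
_++ᶜ_ : ∀ {a b q} → (Fin a → Fin q) → (Fin b → Fin q) → Fin (a + b) → Fin q
_++ᶜ_ {zero}  g₁ g₂ = g₂
_++ᶜ_ {suc a} g₁ g₂ = consF (g₁ fz) ((g₁ ∘ fs) ++ᶜ g₂)

sum-allFin-suc : ∀ n (f : Fin (suc n) → ℕ) →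
                 sum (map f (allFin (suc n))) ≡ f fz + sum (map (f ∘ fs) (allFin n))
sum-allFin-suc n f = cong sum (map-allFin-suc n f)

sum-map-cong : ∀ {A : Set} (xs : List A) {f g : A → ℕ} → (∀ x → f x ≡ g x) →
               sum (map f xs) ≡ sum (map g xs)
sum-map-cong xs f≡g = cong sum (List.map-cong f≡g xs)

sum-map-zero : ∀ {A : Set} (xs : List A) {f : A → ℕ} → (∀ x → f x ≡ 0) → sum (map f xs) ≡ 0
sum-map-zero []       f≡0 = refl
sum-map-zero (x ∷ xs) f≡0 = cong₂ _+_ (f≡0 x) (sum-map-zero xs f≡0)

module _ {q : ℕ} where

  occurrences : ∀ {n} → Fin q → (Fin n → Fin q) → ℕ
  occurrences {n} c g = sum (map (λ j → indicator ⌊ c F.≟ g j ⌋) (allFin n))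

  occurrencesInV₂ : ∀ a b → Fin q → (Fin (a + b) → Fin q) → ℕ
  occurrencesInV₂ a b c f = sum (map (λ j → indicator (not (inV₁ a b j) ∧ ⌊ c F.≟ f j ⌋)) (allFin (a + b)))

  monoEdge : ∀ {n} → Graph n → (Fin n → Fin q) → Fin n → Fin n → ℕ
  monoEdge G f i j = indicator (G i j ∧ ⌊ toℕ i <? toℕ j ⌋ ∧ ⌊ f i F.≟ f j ⌋)

  lookup-counts : ∀ {n} (g : Fin n → Fin q) c → lookup (counts g) c ≡ occurrences c g
  lookup-counts {zero}  g c = lookup-zeros c
  lookup-counts {suc n} g c = begin
    lookup (bump (g fz) (counts (g ∘ fs))) c
      ≡⟨ lookup-bump (g fz) c (counts (g ∘ fs)) ⟩
    indicator ⌊ c F.≟ g fz ⌋ + lookup (counts (g ∘ fs)) c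
      ≡⟨ cong (_+_ (indicator ⌊ c F.≟ g fz ⌋)) (lookup-counts (g ∘ fs) c) ⟩
    indicator ⌊ c F.≟ g fz ⌋ + occurrences c (g ∘ fs)
      ≡⟨ sum-allFin-suc n (λ j → indicator ⌊ c F.≟ g j ⌋) ⟨
    occurrences c g ∎
    where open ≡-Reasoning

  inV₁-suc : ∀ a b (i : Fin (a + b)) → inV₁ (suc a) b (fs i) ≡ inV₁ a b i
  inV₁-suc a b i = <?-suc (toℕ i) a

  mono-K-zero : ∀ b (f : Fin b → Fin q) → mono (K 0 b) f ≡ 0
  mono-K-zero b f = sum-map-zero (allFin b) (λ i → sum-map-zero (allFin b) (λ j → refl))

  mono-K-suc : ∀ a b (f : Fin (suc a + b) → Fin q) →
               mono (K (suc a) b) f ≡ occurrencesInV₂ a b (f fz) (f ∘ fs) + mono (K a b) (f ∘ fs)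
  mono-K-suc a b f =
    trans (sum-allFin-suc (a + b) row) (cong₂ _+_ first-row (sum-map-cong (allFin (a + b)) later-row))
    where
    row : Fin (suc a + b) → ℕ
    row i = sum (map (monoEdge (K (suc a) b) f i) (allFin (suc a + b)))
    first-row : row fz ≡ occurrencesInV₂ a b (f fz) (f ∘ fs)
    first-row = trans (sum-allFin-suc (a + b) (monoEdge (K (suc a) b) f fz)) (sum-map-cong (allFin (a + b))
      (λ j → cong (λ x → indicator (not x ∧ ⌊ f fz F.≟ f (fs j) ⌋)) (inV₁-suc a b j)))
    later-edge : ∀ i j → monoEdge (K (suc a) b) f (fs i) (fs j) ≡ monoEdge (K a b) (f ∘ fs) i j
    later-edge i j = cong₂ (λ e l → indicator (e ∧ l ∧ ⌊ f (fs i) F.≟ f (fs j) ⌋))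
      (cong₂ _xor_ (inV₁-suc a b i) (inV₁-suc a b j)) (<?-suc (toℕ i) (toℕ j))
    later-row : ∀ i → row (fs i) ≡ sum (map (monoEdge (K a b) (f ∘ fs) i) (allFin (a + b)))
    later-row i = trans (sum-allFin-suc (a + b) (monoEdge (K (suc a) b) f (fs i)))
      (cong₂ _+_ (cong indicator (∧-zeroʳ (K (suc a) b (fs i) fz))) (sum-map-cong (allFin (a + b)) (later-edge i)))

  occurrencesInV₂-++ᶜ : ∀ a b c (g₁ : Fin a → Fin q) (g₂ : Fin b → Fin q) →
                         occurrencesInV₂ a b c (g₁ ++ᶜ g₂) ≡ occurrences c g₂
  occurrencesInV₂-++ᶜ zero    b c g₁ g₂ = refl
  occurrencesInV₂-++ᶜ (suc a) b c g₁ g₂ = begin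
    occurrencesInV₂ (suc a) b c (g₁ ++ᶜ g₂)
      ≡⟨ sum-allFin-suc (a + b) (λ j → indicator (not (inV₁ (suc a) b j) ∧ ⌊ c F.≟ (g₁ ++ᶜ g₂) j ⌋)) ⟩
    sum (map (λ j → indicator (not (inV₁ (suc a) b (fs j)) ∧ ⌊ c F.≟ g j ⌋)) (allFin (a + b)))
      ≡⟨ sum-map-cong (allFin (a + b))
           (λ j → cong (λ x → indicator (not x ∧ ⌊ c F.≟ g j ⌋)) (inV₁-suc a b j)) ⟩
    occurrencesInV₂ a b c g
      ≡⟨ occurrencesInV₂-++ᶜ a b c (g₁ ∘ fs) g₂ ⟩
    occurrences c g₂ ∎
    where
    open ≡-Reasoning
    g = (g₁ ∘ fs) ++ᶜ g₂

  mono-K-++ᶜ : ∀ a b (g₁ : Fin a → Fin q) (g₂ : Fin b → Fin q) →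
               mono (K a b) (g₁ ++ᶜ g₂) ≡ counts g₁ · counts g₂
  mono-K-++ᶜ zero    b g₁ g₂ = trans (mono-K-zero b g₂) (sym (·-zeros (counts g₂)))
  mono-K-++ᶜ (suc a) b g₁ g₂ = begin
    mono (K (suc a) b) (g₁ ++ᶜ g₂)
      ≡⟨ mono-K-suc a b (g₁ ++ᶜ g₂) ⟩
    occurrencesInV₂ a b (g₁ fz) ((g₁ ∘ fs) ++ᶜ g₂) + mono (K a b) ((g₁ ∘ fs) ++ᶜ g₂)
      ≡⟨ cong₂ _+_ (occurrencesInV₂-++ᶜ a b (g₁ fz) (g₁ ∘ fs) g₂) (mono-K-++ᶜ a b (g₁ ∘ fs) g₂) ⟩
    occurrences (g₁ fz) g₂ + counts (g₁ ∘ fs) · counts g₂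
      ≡⟨ cong (_+ counts (g₁ ∘ fs) · counts g₂) (lookup-counts g₂ (g₁ fz)) ⟨
    lookup (counts g₂) (g₁ fz) + counts (g₁ ∘ fs) · counts g₂
      ≡⟨ bump-· (g₁ fz) (counts (g₁ ∘ fs)) (counts g₂) ⟨
    counts g₁ · counts g₂ ∎
    where open ≡-Reasoning

-- Sums over colourings

Σ-colourings-suc : ∀ n q (G : (Fin (suc n) → Fin q) → Poly) →
                   Σ (colourings (suc n) q) G ≡ Σ (allFin q) (λ c → Σ (colourings n q) (G ∘ consF c))
Σ-colourings-suc n q G = trans (Σ-concatMap (λ c → map (consF c) (colourings n q)) (allFin q) G)
                               (Σ-cong (allFin q) (λ c → Σ-map (consF c) (colourings n q) G))

Σ-colourings-++ᶜ : ∀ a b q (G : (Fin (a + b) → Fin q) → Poly) →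
  Σ (colourings (a + b) q) G ≡ Σ (colourings a q) (λ g₁ → Σ (colourings b q) (λ g₂ → G (g₁ ++ᶜ g₂)))
Σ-colourings-++ᶜ zero    b q G = sym (+P-identityʳ (Σ (colourings b q) G))
Σ-colourings-++ᶜ (suc a) b q G = begin
  Σ (colourings (suc a + b) q) G
    ≡⟨ Σ-colourings-suc (a + b) q G ⟩
  Σ (allFin q) (λ c → Σ (colourings (a + b) q) (G ∘ consF c))
    ≡⟨ Σ-cong (allFin q) (λ c → Σ-colourings-++ᶜ a b q (G ∘ consF c)) ⟩
  Σ (allFin q) (λ c → Σ (colourings a q) (λ g₁ → Σ (colourings b q) (λ g₂ → G (consF c (g₁ ++ᶜ g₂)))))
    ≡⟨ Σ-colourings-suc a q (λ g₁ → Σ (colourings b q) (λ g₂ → G (g₁ ++ᶜ g₂))) ⟨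
  Σ (colourings (suc a) q) (λ g₁ → Σ (colourings b q) (λ g₂ → G (g₁ ++ᶜ g₂))) ∎
  where open ≡-Reasoning

Σ-colourings-peel : ∀ {q} n (F : Counts (suc q) → Poly) →
  Σ (colourings n (suc q)) (F ∘ counts)
  ≡ antidiagonal n (λ j k → binomialScale j k (Σ (colourings k q) (λ h → F (j , counts h))))
Σ-colourings-peel {q} zero    F = sym (scaleP-identity (F (0 , zeros q) +P []))
Σ-colourings-peel {q} (suc n) F = begin
  Σ (colourings (suc n) (suc q)) (F ∘ counts)
    ≡⟨ Σ-colourings-suc n (suc q) (F ∘ counts) ⟩
  Σ (allFin (suc q)) (λ c → Σ (colourings n (suc q)) (λ g → F (bump c (counts g))))
    ≡⟨ cong sumP (map-allFin-suc q (λ c → Σ (colourings n (suc q)) (λ g → F (bump c (counts g))))) ⟩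
  Σ (colourings n (suc q)) (F₀ ∘ counts)
    +P Σ (allFin q) (λ d → Σ (colourings n (suc q)) (λ g → F (bump (fs d) (counts g))))
    ≡⟨ cong (Σ (colourings n (suc q)) (F₀ ∘ counts) +P_)
            (Σ-comm (allFin q) (colourings n (suc q)) (λ d g → F (bump (fs d) (counts g)))) ⟩
  Σ (colourings n (suc q)) (F₀ ∘ counts) +P Σ (colourings n (suc q)) (F₁ ∘ counts)
    ≡⟨ cong₂ _+P_ (Σ-colourings-peel n F₀) (Σ-colourings-peel n F₁) ⟩
  antidiagonal n (λ j k → binomialScale j k (X (suc j) k))
    +P antidiagonal n (λ j k → binomialScale j k (Σ (colourings k q) (λ h → F₁ (j , counts h))))
    ≡⟨ cong (antidiagonal n (λ j k → binomialScale j k (X (suc j) k)) +P_)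
            (antidiagonal-cong n (λ j k _ → cong (binomialScale j k) (new-colour j k))) ⟩
  antidiagonal n (λ j k → binomialScale j k (X (suc j) k))
    +P antidiagonal n (λ j k → binomialScale j k (X j (suc k)))
    ≡⟨ antidiagonal-pascal n X ⟨
  antidiagonal (suc n) (λ j k → binomialScale j k (X j k)) ∎
  where
  open ≡-Reasoning
  X : ℕ → ℕ → Poly
  X j k = Σ (colourings k q) (λ h → F (j , counts h))
  F₀ F₁ : Counts (suc q) → Poly
  F₀ (m , v) = F (suc m , v)
  F₁ (m , v) = Σ (allFin q) (λ d → F (m , bump d v))
  new-colour : ∀ j k → Σ (colourings k q) (λ h → F₁ (j , counts h)) ≡ X j (suc k)
  new-colour j k = trans (Σ-comm (colourings k q) (allFin q) (λ h d → F (j , bump d (counts h))))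
                         (sym (Σ-colourings-suc k q (λ h → F (j , counts h))))

potts : ℕ → ℕ → ℕ → Poly
potts q a b = Σ (colourings (a + b) q) (λ f → tPow (mono (K a b) f))

pottsByCounts : ℕ → ℕ → ℕ → Poly
pottsByCounts q a b = Σ (colourings a q) (λ g₁ → Σ (colourings b q) (λ g₂ → tPow (counts g₁ · counts g₂)))

potts≡pottsByCounts : ∀ q a b → potts q a b ≡ pottsByCounts q a b
potts≡pottsByCounts q a b = trans (Σ-colourings-++ᶜ a b q (λ f → tPow (mono (K a b) f)))
  (Σ-cong (colourings a q) (λ g₁ → Σ-cong (colourings b q) (λ g₂ → cong tPow (mono-K-++ᶜ a b g₁ g₂))))

Σ-tPow-+ : ∀ {A : Set} (xs : List A) m (e : A → ℕ) →
           Σ xs (λ x → tPow (m + e x)) ≋ tPow m *P Σ xs (tPow ∘ e)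
Σ-tPow-+ xs m e = ≋-trans (Σ-cong≋ xs (λ x → tPow-+ m (e x))) (Σ-*P xs (tPow m) (tPow ∘ e))

pottsByCounts-suc : ∀ q a b → pottsByCounts (suc q) a b ≋
  antidiagonal a (λ i k → binomialScale i k (antidiagonal b (λ j l →
    binomialScale j l (tPow (i * j) *P pottsByCounts q k l))))
pottsByCounts-suc q a b = begin
  pottsByCounts (suc q) a b
    ≡⟨ Σ-colourings-peel a (λ u → Σ (colourings b (suc q)) (λ g₂ → tPow (u · counts g₂))) ⟩
  antidiagonal a (λ i k → binomialScale i k (Σ (colourings k q) (λ h₁ →
    Σ (colourings b (suc q)) (λ g₂ → tPow ((i , counts h₁) · counts g₂)))))
    ≡⟨ antidiagonal-cong a (λ i k _ → cong (binomialScale i k) (peel-V₂ i k)) ⟩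
  antidiagonal a (λ i k → binomialScale i k (antidiagonal b (λ j l → binomialScale j l (X i j k l))))
    ≈⟨ antidiagonal-cong≋ a (λ i k → scaleP-cong (fromℕ (binomial i k))
         (antidiagonal-cong≋ b (λ j l → scaleP-cong (fromℕ (binomial j l)) (X≋ i j k l)))) ⟩
  antidiagonal a (λ i k → binomialScale i k (antidiagonal b (λ j l →
    binomialScale j l (tPow (i * j) *P pottsByCounts q k l)))) ∎
  where
  open ≋-Reasoning
  X : ℕ → ℕ → ℕ → ℕ → Poly
  X i j k l =
    Σ (colourings l q) (λ h₂ → Σ (colourings k q) (λ h₁ → tPow ((i , counts h₁) · (j , counts h₂))))
  peel-V₂ : ∀ i k →
    Σ (colourings k q) (λ h₁ → Σ (colourings b (suc q)) (λ g₂ → tPow ((i , counts h₁) · counts g₂)))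
    ≡ antidiagonal b (λ j l → binomialScale j l (X i j k l))
  peel-V₂ i k = trans (Σ-comm (colourings k q) (colourings b (suc q)) _)
    (Σ-colourings-peel b (λ u → Σ (colourings k q) (λ h₁ → tPow ((i , counts h₁) · u))))
  X≋ : ∀ i j k l → X i j k l ≋ tPow (i * j) *P pottsByCounts q k l
  X≋ i j k l = begin
    X i j k l
      ≡⟨ Σ-comm (colourings l q) (colourings k q) (λ h₂ h₁ → tPow (i * j + counts h₁ · counts h₂)) ⟩
    Σ (colourings k q) (λ h₁ → Σ (colourings l q) (λ h₂ → tPow (i * j + counts h₁ · counts h₂)))
      ≈⟨ Σ-cong≋ (colourings k q) (λ h₁ → Σ-tPow-+ (colourings l q) (i * j) (λ h₂ → counts h₁ · counts h₂)) ⟩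
    Σ (colourings k q) (λ h₁ → tPow (i * j) *P row h₁)
      ≈⟨ Σ-*P (colourings k q) (tPow (i * j)) row ⟩
    tPow (i * j) *P pottsByCounts q k l ∎
    where
    row : (Fin k → Fin q) → Poly
    row h₁ = Σ (colourings l q) (λ h₂ → tPow (counts h₁ · counts h₂))

weight-binomial-antidiagonal : ∀ a b (Y : ℕ → ℕ → ℕ → ℕ → Poly) →
  scaleP (weight a b)
    (antidiagonal a (λ i k → binomialScale i k (antidiagonal b (λ j l → binomialScale j l (Y i j k l)))))
  ≡ antidiagonal a (λ i k → antidiagonal b (λ j l → scaleP (weight i j ℚ.* weight k l) (Y i j k l)))
weight-binomial-antidiagonal a b Y = begin
  scaleP (weight a b) (antidiagonal a (λ i k → binomialScale i k (inner i k)))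
    ≡⟨ antidiagonal-scaleP a (weight a b) (λ i k → binomialScale i k (inner i k)) ⟨
  antidiagonal a (λ i k → scaleP (weight a b) (binomialScale i k (inner i k)))
    ≡⟨ antidiagonal-cong a term ⟩
  antidiagonal a (λ i k → antidiagonal b (λ j l → scaleP (weight i j ℚ.* weight k l) (Y i j k l))) ∎
  where
  open ≡-Reasoning
  inner : ℕ → ℕ → Poly
  inner i k = antidiagonal b (λ j l → binomialScale j l (Y i j k l))
  term : ∀ i k → i + k ≡ a → scaleP (weight a b) (binomialScale i k (inner i k))
                             ≡ antidiagonal b (λ j l → scaleP (weight i j ℚ.* weight k l) (Y i j k l))
  term i k i+k≡a = begin
    scaleP (weight a b) (binomialScale i k (inner i k))
      ≡⟨ scaleP-assoc (weight a b) c (inner i k) ⟩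
    scaleP (weight a b ℚ.* c) (inner i k)
      ≡⟨ antidiagonal-scaleP b (weight a b ℚ.* c) (λ j l → binomialScale j l (Y i j k l)) ⟨
    antidiagonal b (λ j l → scaleP (weight a b ℚ.* c) (binomialScale j l (Y i j k l)))
      ≡⟨ antidiagonal-cong b (λ j l j+l≡b → trans (scaleP-assoc (weight a b ℚ.* c) (c′ j l) (Y i j k l))
                                                  (cong (λ d → scaleP d (Y i j k l)) (scalar j l j+l≡b))) ⟩
    antidiagonal b (λ j l → scaleP (weight i j ℚ.* weight k l) (Y i j k l)) ∎
    where
    c = fromℕ (binomial i k)
    c′ = λ j l → fromℕ (binomial j l)
    scalar : ∀ j l → j + l ≡ b → (weight a b ℚ.* c) ℚ.* c′ j l ≡ weight i j ℚ.* weight k l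
    scalar j l j+l≡b = trans (ℚ.*-assoc (weight a b) c (c′ j l)) (weight-binomial i j k l i+k≡a j+l≡b)

weighted-pottsByCounts≋expSeries^ : ∀ q a b → scaleP (weight a b) (pottsByCounts q a b) ≋ (expSeries ^S q) a b
weighted-pottsByCounts≋expSeries^ zero    zero    zero    = ≋-refl
weighted-pottsByCounts≋expSeries^ zero    zero    (suc b) = ≋-refl
weighted-pottsByCounts≋expSeries^ zero    (suc a) b       = ≋-refl
weighted-pottsByCounts≋expSeries^ (suc q) a b             = begin
  scaleP (weight a b) (pottsByCounts (suc q) a b)
    ≈⟨ scaleP-cong (weight a b) (pottsByCounts-suc q a b) ⟩
  scaleP (weight a b)
    (antidiagonal a (λ i k → binomialScale i k (antidiagonal b (λ j l → binomialScale j l (Y i j k l)))))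
    ≡⟨ weight-binomial-antidiagonal a b Y ⟩
  antidiagonal a (λ i k → antidiagonal b (λ j l → scaleP (weight i j ℚ.* weight k l) (Y i j k l)))
    ≈⟨ antidiagonal-cong≋ a (λ i k → antidiagonal-cong≋ b (λ j l → expSeries-*P i j k l)) ⟨
  antidiagonal a (λ i k → antidiagonal b (λ j l → expSeries i j *P (expSeries ^S q) k l))
    ≡⟨ *S-antidiagonal expSeries (expSeries ^S q) a b ⟨
  (expSeries ^S suc q) a b ∎
  where
  open ≋-Reasoning
  Y : ℕ → ℕ → ℕ → ℕ → Poly
  Y i j k l = tPow (i * j) *P pottsByCounts q k l
  expSeries-*P : ∀ i j k l →
                 expSeries i j *P (expSeries ^S q) k l ≋ scaleP (weight i j ℚ.* weight k l) (Y i j k l)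
  expSeries-*P i j k l = begin
    scaleP (weight i j) (tPow (i * j)) *P (expSeries ^S q) k l
      ≈⟨ *P-congˡ (scaleP (weight i j) (tPow (i * j))) (weighted-pottsByCounts≋expSeries^ q k l) ⟨
    scaleP (weight i j) (tPow (i * j)) *P scaleP (weight k l) (pottsByCounts q k l)
      ≡⟨ *P-scaleˡ (weight i j) (tPow (i * j)) _ ⟩
    scaleP (weight i j) (tPow (i * j) *P scaleP (weight k l) (pottsByCounts q k l))
      ≡⟨ cong (scaleP (weight i j)) (*P-scaleʳ (weight k l) (tPow (i * j)) (pottsByCounts q k l)) ⟩
    scaleP (weight i j) (scaleP (weight k l) (Y i j k l))
      ≡⟨ scaleP-assoc (weight i j) (weight k l) (Y i j k l) ⟩
    scaleP (weight i j ℚ.* weight k l) (Y i j k l) ∎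

module *ℚ = CommSemigroupProperties
  (CommutativeMonoid.commutativeSemigroup (CommutativeRing.*-commutativeMonoid ℚ.+-*-commutativeRing))

scaleP-fromℕ-cancel : ∀ q .{{_ : NonZero q}} c p →
                      scaleP (fromℕ q) (scaleP c (scaleP (+ 1 / q) p)) ≡ scaleP c p
scaleP-fromℕ-cancel q c p = begin
  scaleP (fromℕ q) (scaleP c (scaleP (+ 1 / q) p))
    ≡⟨ cong (scaleP (fromℕ q)) (scaleP-assoc c (+ 1 / q) p) ⟩
  scaleP (fromℕ q) (scaleP (c ℚ.* (+ 1 / q)) p)
    ≡⟨ scaleP-assoc (fromℕ q) (c ℚ.* (+ 1 / q)) p ⟩
  scaleP (fromℕ q ℚ.* (c ℚ.* (+ 1 / q))) p
    ≡⟨ cong (λ d → scaleP d p) (*ℚ.x∙yz≈y∙xz (fromℕ q) c (+ 1 / q)) ⟩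
  scaleP (c ℚ.* (fromℕ q ℚ.* (+ 1 / q))) p
    ≡⟨ cong (λ d → scaleP (c ℚ.* d) p) (fromℕ-*-/ q) ⟩
  scaleP (c ℚ.* 1ℚ) p
    ≡⟨ cong (λ d → scaleP d p) (ℚ.*-identityʳ c) ⟩
  scaleP c p ∎
  where open ≡-Reasoning

lhsSeries≡weighted-potts : ∀ q .{{_ : NonZero q}} a b → lhsSeries q a b ≡ scaleP (weight a b) (potts q a b)
lhsSeries≡weighted-potts q zero    zero    = refl
lhsSeries≡weighted-potts q zero    (suc b) = scaleP-fromℕ-cancel q (weight 0 (suc b)) (potts q 0 (suc b))
lhsSeries≡weighted-potts q (suc a) b       = scaleP-fromℕ-cancel q (weight (suc a) b) (potts q (suc a) b)

proposition3p1 : (q : ℕ) → .{{_ : NonZero q}} → lhsSeries q ≈S (expSeries ^S q)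
proposition3p1 q a b = coeff-≡ (begin
  lhsSeries q a b                            ≡⟨ lhsSeries≡weighted-potts q a b ⟩
  scaleP (weight a b) (potts q a b)          ≡⟨ cong (scaleP (weight a b)) (potts≡pottsByCounts q a b) ⟩
  scaleP (weight a b) (pottsByCounts q a b)  ≈⟨ weighted-pottsByCounts≋expSeries^ q a b ⟩
  (expSeries ^S q) a b                       ∎)
  where open ≋-Reasoning
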